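{- Let $B_0=(b_{ij})$ be a skew-symmetrizable integer $n\times n$ matrix, $t_0\overset{k}{ - }t_1$ an edge of $\mathbb{T}_n$, $B_1=\mu_k(B_0)$, and $t$ a vertex of $\mathbb{T}_n$. If $D_t^{B_0;t_0}$ has signed columns, then $$J_kD_t^{B_0;t_0}+\bigl[|B_0^{k\bullet}|\,D_t^{B_0;t_0}\bigr]_+=\sigma_kD_t^{B_0;t_0}.$$
   Context: $\mathbb{T}_n$ is the $n$-regular tree whose edges are labeled by $1,\dots,n$ so that the $n$ edges at each vertex have distinct labels; $t\overset{k}{ - }t'$ means an edge labeled $k$. $[a]_+=\max(a,0)$. For a skew-symmetrizable integer matrix $B=(b_{ij})$, the mutation $\mu_k(B)=(b'_{ij})$ has $b'_{ij}=-b_{ij}$ if $i=k$ or $j=k$, and $b'_{ij}=b_{ij}+\mathrm{sgn}(b_{ik})[b_{ik}b_{kj}]_+$ otherwise. Given $B_0$ and a vertex $t_0$, the coefficient-free cluster pattern assigns to each vertex $t$ an exchange matrix $B_t^{B_0;t_0}=(b_{ij;t})$ and cluster $(x_{1;t},\dots,x_{n;t})$ in $\mathbb{Q}(x_1,\dots,x_n)$ with $B_{t_0}=B_0$, $x_{i;t_0}=x_i$, and for each edge $t\overset{k}{ - }t'$: $B_{t'}=\mu_k(B_t)$, $x_{j;t'}=x_{j;t}$ ($j\ne k$), $x_{k;t'}x_{k;t}=\prod_\ell x_{\ell;t}^{[b_{\ell k;t}]_+}+\prod_\ell x_{\ell;t}^{[-b_{\ell k;t}]_+}$. Each $x_{j;t}^{B_0;t_0}$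 is a Laurent polynomial in $x_1,\dots,x_n$; $D_t^{B_0;t_0}$ has $(i,j)$ entry equal to minus the lowest power of $x_i$ in the Laurent expansion of $x_{j;t}^{B_0;t_0}$. A matrix has signed columns if each column has all entries $\ge0$ or all entries $\le0$. $A^{k\bullet}$ is $A$ with all entries outside row $k$ replaced by $0$; $J_k$ is the identity matrix with $(k,k)$ entry replaced by $-1$; $|\cdot|$ and $[\cdot]_+$ act entrywise. For $v\in\mathbb{Z}^n$, $\sigma_k(v)_i=v_i$ for $i\ne k$ and $\sigma_k(v)_k=-v_k+\sum_{\ell=1}^n|b_{k\ell}|\,[v_\ell]_+$; $\sigma_k$ acts on matrices column by column. -}

module Defs where

open import Data.Nat using (ℕ; zero; suc) renaming (_<_ to _<ℕ_)
open import Data.Integer as ℤ using (ℤ; +_; -[1+_]; ∣_∣) renaming (_+_ to _+ℤ_; _*_ to _*ℤ_; -_ to -ℤ_; _≤_ to _≤ℤ_)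
open import Data.Rational as ℚ using (ℚ; 0ℚ; 1ℚ) renaming (_+_ to _+ℚ_; _*_ to _*ℚ_)
open import Data.Fin using (Fin; zero; suc)
open import Data.Fin.Properties using () renaming (_≟_ to _≟F_)
open import Data.Vec using (Vec; []; _∷_; lookup; tabulate; zipWith; replicate)
open import Data.Vec.Properties using (≡-dec)
open import Data.List using (List; []; _∷_; _++_; concatMap; map)
open import Data.Product using (Σ; _×_; _,_; ∃; ∃-syntax)
open import Relation.Binary.PropositionalEquality using (_≡_; _≢_)
open import Relation.Nullary using (yes; no)
import Data.Integer.Properties as ℤP

Mat : ℕ → Set
Mat n = Fin n → Fin n → ℤ

[_]₊ : ℤ → ℤ
[ + m ]₊ = + m
[ -[1+ m ] ]₊ = + 0

sgn : ℤ → ℤ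
sgn (+ zero) = + 0
sgn (+ suc _) = + 1
sgn -[1+ _ ] = -[1+ 0 ]

absℤ : ℤ → ℤ
absℤ a = + ∣ a ∣

sumFin : (n : ℕ) → (Fin n → ℤ) → ℤ
sumFin zero f = + 0
sumFin (suc n) f = f zero +ℤ sumFin n (λ i → f (suc i))

SkewSymmetrizable : {n : ℕ} → Mat n → Set
SkewSymmetrizable {n} B =
  Σ (Fin n → ℕ) λ d → ((i : Fin n) → 0 <ℕ d i) ×
    ((i j : Fin n) → (+ d i) *ℤ B i j ≡ -ℤ ((+ d j) *ℤ B j i))

μ : {n : ℕ} → Fin n → Mat n → Mat n
μ k B i j with i ≟F k | j ≟F k
... | yes _ | _     = -ℤ B i j
... | no _  | yes _ = -ℤ B i j
... | no _  | no _  = B i j +ℤ sgn (B i k) *ℤ [ B i k *ℤ B k j ]₊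

-- Laurent polynomials over ℚ in x_1..x_n: finite formal sums of terms
-- c · x^m  (m ∈ ℤ^n), equality via coefficient extraction.

Mono : ℕ → Set
Mono n = Vec ℤ n

LP : ℕ → Set
LP n = List (ℚ × Mono n)

coeff : {n : ℕ} → LP n → Mono n → ℚ
coeff [] m = 0ℚ
coeff ((c , m') ∷ L) m with ≡-dec ℤ._≟_ m' m
... | yes _ = c +ℚ coeff L m
... | no _  = coeff L m

_≈LP_ : {n : ℕ} → LP n → LP n → Set
L ≈LP L' = ∀ m → coeff L m ≡ coeff L' m

oneLP : {n : ℕ} → LP n
oneLP {n} = (1ℚ , replicate n (+ 0)) ∷ []

varLP : {n : ℕ} → Fin n → LP n
varLP {n} i = (1ℚ , tabulate (λ j → unit j)) ∷ []
  where
  unit : Fin n → ℤ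
  unit j with j ≟F i
  ... | yes _ = + 1
  ... | no _  = + 0

_+LP_ : {n : ℕ} → LP n → LP n → LP n
L +LP L' = L ++ L'

_*LP_ : {n : ℕ} → LP n → LP n → LP n
L *LP L' = concatMap (λ { (c , m) → map (λ { (c' , m') → (c *ℚ c' , zipWith _+ℤ_ m m') }) L' }) L

-- Rational functions in ℚ(x_1,...,x_n), as formal fractions num/den of
-- Laurent polynomials.

record Frac (n : ℕ) : Set where
  constructor _/_
  field
    num : LP n
    den : LP n
open Frac public

varF : {n : ℕ} → Fin n → Frac n
varF i = varLP i / oneLP

oneF : {n : ℕ} → Frac n
oneF = oneLP / oneLP

_*F_ : {n : ℕ} → Frac n → Frac n → Frac n
(a / b) *F (c / d) = (a *LP c) / (b *LP d)

_+F_ : {n : ℕ} → Frac n → Frac n → Frac n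
(a / b) +F (c / d) = ((a *LP d) +LP (c *LP b)) / (b *LP d)

_÷F_ : {n : ℕ} → Frac n → Frac n → Frac n
(a / b) ÷F (c / d) = (a *LP d) / (b *LP c)

_^F_ : {n : ℕ} → Frac n → ℕ → Frac n
f ^F zero = oneF
f ^F suc e = f *F (f ^F e)

prodFin : {m : ℕ} (n : ℕ) → (Fin n → Frac m) → Frac m
prodFin zero f = oneF
prodFin (suc n) f = f zero *F prodFin n (λ i → f (suc i))

record Seed (n : ℕ) : Set where
  constructor seed
  field
    mat : Mat n
    clu : Fin n → Frac n
open Seed public

mutSeed : {n : ℕ} → Fin n → Seed n → Seed n
mutSeed {n} k (seed B x) = seed (μ k B) x'
  where
  P Q : Frac n
  P = prodFin n (λ l → x l ^F ∣ [ B l k ]₊ ∣)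
  Q = prodFin n (λ l → x l ^F ∣ [ -ℤ B l k ]₊ ∣)
  x' : Fin n → Frac n
  x' j with j ≟F k
  ... | yes _ = (P +F Q) ÷F x k
  ... | no _  = x j

-- A vertex t of 𝕋_n is given by the sequence of edge labels of a walk
-- from t₀ to t (first label = first edge taken from t₀).
Vertex : ℕ → Set
Vertex n = List (Fin n)

initialSeed : {n : ℕ} → Mat n → Seed n
initialSeed B₀ = seed B₀ varF

seedAlong : {n : ℕ} → Seed n → Vertex n → Seed n
seedAlong s [] = s
seedAlong s (k ∷ ks) = seedAlong (mutSeed k s) ks

clusterVar : {n : ℕ} → Mat n → Vertex n → Fin n → Frac n
clusterVar B₀ t = clu (seedAlong (initialSeed B₀) t)

IsLaurentExpansion : {n : ℕ} → Frac n → LP n → Set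
IsLaurentExpansion f L = num f ≈LP (L *LP den f)

LowestPower : {n : ℕ} → Fin n → LP n → ℤ → Set
LowestPower i L e =
  (∃[ m ] (coeff L m ≢ 0ℚ × lookup m i ≡ e)) ×
  (∀ m → coeff L m ≢ 0ℚ → e ≤ℤ lookup m i)

IsDMatrix : {n : ℕ} → Mat n → Vertex n → Mat n → Set
IsDMatrix B₀ t D =
  ∀ i j → Σ (LP _) λ L →
    IsLaurentExpansion (clusterVar B₀ t j) L × LowestPower i L (-ℤ D i j)

SignedColumns : {n : ℕ} → Mat n → Set
SignedColumns {n} A =
  ∀ j → ((∀ i → + 0 ≤ℤ A i j)) Data.Sum.⊎ ((∀ i → A i j ≤ℤ + 0))
  where import Data.Sum

_·_ : {n : ℕ} → Mat n → Mat n → Mat n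
_·_ {n} A C i j = sumFin n (λ l → A i l *ℤ C l j)

_+M_ : {n : ℕ} → Mat n → Mat n → Mat n
(A +M C) i j = A i j +ℤ C i j

rowOnly : {n : ℕ} → Fin n → Mat n → Mat n
rowOnly k A i j with i ≟F k
... | yes _ = A i j
... | no _  = + 0

J : {n : ℕ} → Fin n → Mat n
J k i j with i ≟F j | i ≟F k
... | yes _ | yes _ = -[1+ 0 ]
... | yes _ | no _  = + 1
... | no _  | _     = + 0

absM : {n : ℕ} → Mat n → Mat n
absM A i j = absℤ (A i j)

posM : {n : ℕ} → Mat n → Mat n
posM A i j = [ A i j ]₊

σ : {n : ℕ} → Mat n → Fin n → Mat n → Mat n
σ {n} B k V i j with i ≟F k
... | yes _ = -ℤ V k j +ℤ sumFin n (λ l → absℤ (B k l) *ℤ [ V l j ]₊)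
... | no _  = V i j

module Submission where

-- Proposition 2.6 is a pure statement about integer matrices: the cluster
-- pattern only enters through the hypothesis that the columns of D are
-- sign-coherent, and the identity holds for every matrix B₀ and every D with
-- signed columns.
--
--  * Row i ≠ k.  J_k acts as the identity on row i, |B₀^{k•}| has a zero
--    row i, and σ_k fixes row i; both sides equal D_ij.
--  * Row k.  (J_k D)_kj = -D_kj and (|B₀^{k•}| D)_kj = Σ_l |b_kl| D_lj, while
--    σ_k D has (k,j) entry -D_kj + Σ_l |b_kl| [D_lj]₊.  So everything reduces
--    to  [Σ_l c_l v_l]₊ = Σ_l c_l [v_l]₊  for nonnegative c and a
--    sign-coherent vector v: if v ≥ 0 both sides are Σ c_l v_l, if v ≤ 0 both
--    are 0.

open import Defs
open import Data.Nat using (ℕ; zero; suc; z≤n)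
open import Data.Fin using (Fin; zero; suc)
open import Data.Fin.Properties using (suc-injective) renaming (_≟_ to _≟F_)
open import Data.Integer using (ℤ; ∣_∣; +_; -[1+_]; _+_; _*_; -_; _≤_; +≤+)
open import Data.Integer.Properties
  using (+-identityˡ; +-identityʳ; *-identityˡ; *-zeroʳ; -1*i≡-i; +-mono-≤; *-monoˡ-≤-nonNeg)
open import Data.Sum using (_⊎_; inj₁; inj₂)
open import Data.Empty using (⊥-elim)
open import Relation.Nullary using (Dec; yes; no; ¬_)
open import Relation.Binary.PropositionalEquality
  using (_≡_; refl; sym; trans; cong; cong₂; subst; module ≡-Reasoning)

open ≡-Reasoning

sumFin-cong : ∀ n {f g : Fin n → ℤ} → (∀ l → f l ≡ g l) → sumFin n f ≡ sumFin n g
sumFin-cong zero    f≡g = refl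
sumFin-cong (suc n) f≡g = cong₂ _+_ (f≡g zero) (sumFin-cong n (λ l → f≡g (suc l)))

sumFin-zero : ∀ n {f : Fin n → ℤ} → (∀ l → f l ≡ + 0) → sumFin n f ≡ + 0
sumFin-zero zero    f≡0 = refl
sumFin-zero (suc n) f≡0 = cong₂ _+_ (f≡0 zero) (sumFin-zero n (λ l → f≡0 (suc l)))

sumFin-single : ∀ n {f : Fin n → ℤ} (i : Fin n) → (∀ l → ¬ l ≡ i → f l ≡ + 0) →
  sumFin n f ≡ f i
sumFin-single (suc n) {f} zero f≡0 =
  trans (cong (_+_ (f zero)) (sumFin-zero n (λ l → f≡0 (suc l) (λ ()))))
        (+-identityʳ (f zero))
sumFin-single (suc n) {f} (suc i) f≡0 =
  trans (cong (_+ sumFin n (λ l → f (suc l))) (f≡0 zero (λ ())))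
        (trans (+-identityˡ _) (sumFin-single n i vanishesOff))
  where
  vanishesOff : ∀ l → ¬ l ≡ i → f (suc l) ≡ + 0
  vanishesOff l l≢i = f≡0 (suc l) (λ eq → l≢i (suc-injective eq))

sumFin-mono : ∀ n {f g : Fin n → ℤ} → (∀ l → f l ≤ g l) → sumFin n f ≤ sumFin n g
sumFin-mono zero    f≤g = +≤+ z≤n
sumFin-mono (suc n) f≤g = +-mono-≤ (f≤g zero) (sumFin-mono n (λ l → f≤g (suc l)))

[]₊-nonNeg : ∀ {a} → + 0 ≤ a → [ a ]₊ ≡ a
[]₊-nonNeg {+ _} _ = refl

[]₊-nonPos : ∀ {a} → a ≤ + 0 → [ a ]₊ ≡ + 0
[]₊-nonPos { -[1+ _ ]} _          = refl
[]₊-nonPos {+ zero}    _          = refl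
[]₊-nonPos {+ suc _}   (+≤+ ())

SignCoherent : (n : ℕ) → (Fin n → ℤ) → Set
SignCoherent n v = (∀ l → + 0 ≤ v l) ⊎ (∀ l → v l ≤ + 0)

[]₊-sum-signCoherent : ∀ n (c : Fin n → ℕ) (v : Fin n → ℤ) → SignCoherent n v →
  [ sumFin n (λ l → + c l * v l) ]₊ ≡ sumFin n (λ l → + c l * [ v l ]₊)
[]₊-sum-signCoherent n c v (inj₁ v≥0) = begin
  [ sumFin n (λ l → + c l * v l) ]₊      ≡⟨ []₊-nonNeg combination≥0 ⟩
  sumFin n (λ l → + c l * v l)          ≡⟨ sumFin-cong n (λ l → cong (_*_ (+ c l)) (sym ([]₊-nonNeg (v≥0 l)))) ⟩
  sumFin n (λ l → + c l * [ v l ]₊)      ∎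
  where
  combination≥0 : + 0 ≤ sumFin n (λ l → + c l * v l)
  combination≥0 = subst (_≤ sumFin n (λ l → + c l * v l)) (sumFin-zero n (λ l → *-zeroʳ (+ c l)))
    (sumFin-mono n (λ l → *-monoˡ-≤-nonNeg (+ c l) (v≥0 l)))
[]₊-sum-signCoherent n c v (inj₂ v≤0) = begin
  [ sumFin n (λ l → + c l * v l) ]₊      ≡⟨ []₊-nonPos combination≤0 ⟩
  + 0                                   ≡⟨ sym (sumFin-zero n termwise≡0) ⟩
  sumFin n (λ l → + c l * [ v l ]₊)      ∎
  where
  combination≤0 : sumFin n (λ l → + c l * v l) ≤ + 0
  combination≤0 = subst (sumFin n (λ l → + c l * v l) ≤_) (sumFin-zero n (λ l → *-zeroʳ (+ c l)))
    (sumFin-mono n (λ l → *-monoˡ-≤-nonNeg (+ c l) (v≤0 l)))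
  termwise≡0 : ∀ l → + c l * [ v l ]₊ ≡ + 0
  termwise≡0 l = trans (cong (_*_ (+ c l)) ([]₊-nonPos (v≤0 l))) (*-zeroʳ (+ c l))

J-row-k : ∀ {n} (k : Fin n) (D : Mat n) j → (J k · D) k j ≡ - D k j
J-row-k {n} k D j = trans (sumFin-single n k offDiagonal) diagonal
  where
  offDiagonal : ∀ l → ¬ l ≡ k → J k k l * D l j ≡ + 0
  offDiagonal l l≢k with k ≟F l
  ... | yes k≡l = ⊥-elim (l≢k (sym k≡l))
  ... | no  _   = refl
  diagonal : J k k k * D k j ≡ - D k j
  diagonal with k ≟F k
  ... | yes _   = -1*i≡-i (D k j)
  ... | no  k≢k = ⊥-elim (k≢k refl)

J-row-other : ∀ {n} (k i : Fin n) (D : Mat n) j → ¬ i ≡ k → (J k · D) i j ≡ D i j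
J-row-other {n} k i D j i≢k = trans (sumFin-single n i offDiagonal) diagonal
  where
  offDiagonal : ∀ l → ¬ l ≡ i → J k i l * D l j ≡ + 0
  offDiagonal l l≢i with i ≟F l
  ... | yes i≡l = ⊥-elim (l≢i (sym i≡l))
  ... | no  _   = refl
  diagonal : J k i i * D i j ≡ D i j
  diagonal with i ≟F i | i ≟F k
  ... | yes _   | yes i≡k = ⊥-elim (i≢k i≡k)
  ... | yes _   | no  _   = *-identityˡ (D i j)
  ... | no  i≢i | _       = ⊥-elim (i≢i refl)

rowOnly-row-k : ∀ {n} (k : Fin n) (B D : Mat n) j →
  (absM (rowOnly k B) · D) k j ≡ sumFin n (λ l → absℤ (B k l) * D l j)
rowOnly-row-k {n} k B D j = sumFin-cong n termwise
  where
  termwise : ∀ l → absℤ (rowOnly k B k l) * D l j ≡ absℤ (B k l) * D l j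
  termwise l with k ≟F k
  ... | yes _   = refl
  ... | no  k≢k = ⊥-elim (k≢k refl)

rowOnly-row-other : ∀ {n} (k i : Fin n) (B D : Mat n) j → ¬ i ≡ k →
  (absM (rowOnly k B) · D) i j ≡ + 0
rowOnly-row-other {n} k i B D j i≢k = sumFin-zero n termwise
  where
  termwise : ∀ l → absℤ (rowOnly k B i l) * D l j ≡ + 0
  termwise l with i ≟F k
  ... | yes i≡k = ⊥-elim (i≢k i≡k)
  ... | no  _   = refl

σ-row-k : ∀ {n} (B : Mat n) k (D : Mat n) j →
  σ B k D k j ≡ - D k j + sumFin n (λ l → absℤ (B k l) * [ D l j ]₊)
σ-row-k B k D j with k ≟F k
... | yes _   = refl
... | no  k≢k = ⊥-elim (k≢k refl)

σ-row-other : ∀ {n} (B : Mat n) k i (D : Mat n) j → ¬ i ≡ k → σ B k D i j ≡ D i j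
σ-row-other B k i D j i≢k with i ≟F k
... | yes i≡k = ⊥-elim (i≢k i≡k)
... | no  _   = refl

σ-signedColumns-row-k : ∀ {n} (B : Mat n) (k : Fin n) (D : Mat n) → SignedColumns D →
  ∀ j → ((J k · D) +M posM (absM (rowOnly k B) · D)) k j ≡ σ B k D k j
σ-signedColumns-row-k {n} B k D signed j = begin
  (J k · D) k j + [ (absM (rowOnly k B) · D) k j ]₊
    ≡⟨ cong₂ _+_ (J-row-k k D j) (cong [_]₊ (rowOnly-row-k k B D j)) ⟩
  - D k j + [ sumFin n (λ l → absℤ (B k l) * D l j) ]₊
    ≡⟨ cong (_+_ (- D k j)) ([]₊-sum-signCoherent n (λ l → ∣ B k l ∣) (λ l → D l j) (signed j)) ⟩
  - D k j + sumFin n (λ l → absℤ (B k l) * [ D l j ]₊)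
    ≡⟨ sym (σ-row-k B k D j) ⟩
  σ B k D k j ∎

σ-row-other-identity : ∀ {n} (B : Mat n) (k i : Fin n) (D : Mat n) → ¬ i ≡ k →
  ∀ j → ((J k · D) +M posM (absM (rowOnly k B) · D)) i j ≡ σ B k D i j
σ-row-other-identity B k i D i≢k j = begin
  (J k · D) i j + [ (absM (rowOnly k B) · D) i j ]₊
    ≡⟨ cong₂ _+_ (J-row-other k i D j i≢k) (cong [_]₊ (rowOnly-row-other k i B D j i≢k)) ⟩
  D i j + + 0
    ≡⟨ +-identityʳ (D i j) ⟩
  D i j
    ≡⟨ sym (σ-row-other B k i D j i≢k) ⟩
  σ B k D i j ∎

σ-signedColumns : ∀ {n} (B : Mat n) (k : Fin n) (D : Mat n) → SignedColumns D →
  ∀ i j → ((J k · D) +M posM (absM (rowOnly k B) · D)) i j ≡ σ B k D i j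
σ-signedColumns B k D signed i j = byRow (i ≟F k)
  where
  byRow : Dec (i ≡ k) → ((J k · D) +M posM (absM (rowOnly k B) · D)) i j ≡ σ B k D i j
  byRow (yes refl) = σ-signedColumns-row-k B k D signed j
  byRow (no i≢k)   = σ-row-other-identity B k i D i≢k j

-- Proposition 2.6: a D-matrix with signed columns satisfies the identity.
proposition2p6 : (n : ℕ) (B₀ : Mat n) → SkewSymmetrizable B₀ →
    (k : Fin n) (t : Vertex n) (D : Mat n) → IsDMatrix B₀ t D →
    SignedColumns D →
    ∀ i j → ((J k · D) +M posM (absM (rowOnly k B₀) · D)) i j ≡ σ B₀ k D i j
proposition2p6 n B₀ _ k t D _ signed = σ-signedColumns B₀ k D signed
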